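{- Let $n,t$ be positive integers. The set of flags $\{a=(a_1,\dots,a_n) : a_i\le a_{i+1},\ i\le a_i\le n,\ a_i\in t\mathbb{Z}\}$ is in bijection with the set of $312$-avoiding permutations $w\in\mathfrak S_n$ such that $w_k$ is a multiple of $t$ for every ascent $k$ of $w$. The bijection sends $a$ to $w_a=[w_1,\dots,w_n]$ defined by $w_1:=a_1$ and $w_k:=\max\{x : x\le a_k,\ x\ne w_i \text{ for } 1\le i\le k-1\}$.
   Context: A permutation $w=[w_1,\dots,w_n]$ (one-line notation) contains the pattern $312$ if there are $1\le i<j<k\le n$ with $w_j<w_k<w_i$; it is $312$-avoiding otherwise. For $1\le k\le n$, $k$ is an ascent of $w$ if $w_{k-1}<w_k$; by convention $1$ is always an ascent. -}

module Defs where

open import Data.Nat using (ℕ; zero; suc; _≤_; _<_; _≟_)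
open import Data.Nat.Divisibility using (_∣_)
open import Data.Fin using (Fin; toℕ)
open import Data.Vec using (Vec; []; _∷_; lookup)
open import Data.List using (List; []; _∷_)
open import Data.List.Membership.DecPropositional _≟_ using (_∈?_)
open import Data.Product using (Σ; _×_)
open import Data.Sum using (_⊎_)
open import Relation.Binary.PropositionalEquality using (_≡_)
open import Relation.Nullary using (¬_; yes; no)

-- Sequences of length n in one-line notation: Vec ℕ n; position i : Fin n
-- is the (toℕ i + 1)-th entry.

record Flag (n t : ℕ) (a : Vec ℕ n) : Set where
  field
    weak-incr : ∀ (i j : Fin n) → toℕ j ≡ suc (toℕ i) → lookup a i ≤ lookup a j
    lower     : ∀ (i : Fin n) → suc (toℕ i) ≤ lookup a i
    upper     : ∀ (i : Fin n) → lookup a i ≤ n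
    mult      : ∀ (i : Fin n) → t ∣ lookup a i

record IsPerm (n : ℕ) (w : Vec ℕ n) : Set where
  field
    pos   : ∀ (i : Fin n) → 1 ≤ lookup w i
    bound : ∀ (i : Fin n) → lookup w i ≤ n
    inj   : ∀ (i j : Fin n) → lookup w i ≡ lookup w j → i ≡ j

Contains312 : ∀ {n} → Vec ℕ n → Set
Contains312 {n} w = Σ (Fin n) λ i → Σ (Fin n) λ j → Σ (Fin n) λ k →
  (toℕ i < toℕ j) × (toℕ j < toℕ k) ×
  (lookup w j < lookup w k) × (lookup w k < lookup w i)

Avoids312 : ∀ {n} → Vec ℕ n → Set
Avoids312 w = ¬ Contains312 w

IsAscent : ∀ {n} → Vec ℕ n → Fin n → Set
IsAscent {n} w k = (toℕ k ≡ 0) ⊎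
  (Σ (Fin n) λ i → (toℕ k ≡ suc (toℕ i)) × (lookup w i < lookup w k))

Good : (n t : ℕ) → Vec ℕ n → Set
Good n t w = IsPerm n w × Avoids312 w × (∀ (k : Fin n) → IsAscent w k → t ∣ lookup w k)

-- maxFree used m = max { x : 1 ≤ x ≤ m, x ∉ used }  (0 if that set is empty).
maxFree : List ℕ → ℕ → ℕ
maxFree used zero = zero
maxFree used (suc m) with suc m ∈? used
... | yes _ = maxFree used m
... | no  _ = suc m

wGo : ∀ {n} → List ℕ → Vec ℕ n → Vec ℕ n
wGo used [] = []
wGo used (x ∷ xs) = maxFree used x ∷ wGo (maxFree used x ∷ used) xs

-- The map a ↦ w_a (w_1 = a_1 since nothing is used yet, as a_1 ≥ 1).
wOf : ∀ {n} → Vec ℕ n → Vec ℕ n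
wOf a = wGo [] a

{-# OPTIONS --safe #-}
-- Write w = w_a.  Each a_k equals some w_i with i ≤ k (either a_k is still
-- unused at step k, or it was taken earlier), and every w_i with i ≤ k is ≤ a_i ≤ a_k; so a
-- is the sequence of prefix maxima of w_a, which gives injectivity.  Since w_k is the
-- largest unused value ≤ a_k, all of (w_k, a_k] occurs before k: this makes w_k positive
-- (a_k > k), forbids 312 patterns, and at an ascent k forces w_k = a_k ∈ tℤ.  Conversely,
-- for a good w the prefix maxima a form a flag (each maximum sits at an ascent), and the
-- greedy rule recovers w from a: an unused y ∈ (w_k, a_k] would occur after k and, with
-- the earlier position attaining a_k, form a 312 pattern.
module Submission where

open import Defs
open import Data.Nat using (ℕ; zero; suc; pred; >-nonZero; _≤_; _<_; _≟_; _⊔_; z≤n; s≤s; s≤s⁻¹)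
open import Data.Nat.Properties
open import Data.Nat.Divisibility using (_∣_)
open import Data.Fin using (Fin; toℕ; fromℕ<; inject≤; inject₁) renaming (zero to fz; suc to fs)
import Data.Fin.Base as Fin
import Data.Fin.Properties as Finₚ
open import Data.Vec using (Vec; []; _∷_; lookup; map)
open import Data.Vec.Properties using (lookup-map; tabulate∘lookup; tabulate-cong)
open import Data.List using (List; []; _∷_)
open import Data.List.Membership.Propositional using (_∈_)
open import Data.List.Membership.DecPropositional _≟_ using (_∈?_)
open import Data.List.Relation.Unary.Any using (here; there)
open import Data.Product using (Σ; ∃-syntax; _×_; _,_; proj₁; proj₂)
open import Data.Sum using (_⊎_; inj₁; inj₂; map₂)
open import Function using (_∘′_)
open import Function.Definitions using (Injective)
open import Relation.Binary.Definitions using (tri<; tri≈; tri>)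
open import Relation.Binary.PropositionalEquality
open import Relation.Nullary using (¬_; Dec; yes; no; contradiction)
open import Relation.Nullary.Decidable using (_×-dec_)

injective-positive-≤⇒≤ : ∀ {m p} (f : Fin m → ℕ) → Injective _≡_ _≡_ f →
  (∀ i → 1 ≤ f i) → (∀ i → f i ≤ p) → m ≤ p
injective-positive-≤⇒≤ {p = p} f f-inj f-pos f≤p = Finₚ.injective⇒≤ g-inj
  where
  pred< : ∀ {x} → 1 ≤ x → x ≤ p → pred x < p
  pred< {suc x} _ x≤p = x≤p

  g : Fin _ → Fin p
  g i = fromℕ< (pred< (f-pos i) (f≤p i))

  g-inj : Injective _≡_ _≡_ g
  g-inj {i} {j} gi≡gj = f-inj (pred-injective {{>-nonZero (f-pos i)}} {{>-nonZero (f-pos j)}} (begin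
    pred (f i)  ≡⟨ Finₚ.toℕ-fromℕ< _ ⟨
    toℕ (g i)   ≡⟨ cong toℕ gi≡gj ⟩
    toℕ (g j)   ≡⟨ Finₚ.toℕ-fromℕ< _ ⟩
    pred (f j)  ∎))
    where open ≡-Reasoning

isPerm-surjective : ∀ {n} {w : Vec ℕ n} → IsPerm n w → ∀ {y} → 1 ≤ y → y ≤ n → ∃[ l ] lookup w l ≡ y
isPerm-surjective {n} {w} perm {y} 1≤y y≤n with Finₚ.any? (λ l → lookup w l ≟ y)
... | yes hit  = hit
... | no  miss = contradiction (injective-positive-≤⇒≤ f f-inj f-pos f≤n) 1+n≰n
  where
  open IsPerm perm

  f : Fin (suc n) → ℕ
  f fz     = y
  f (fs l) = lookup w l

  f-pos : ∀ i → 1 ≤ f i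
  f-pos fz     = 1≤y
  f-pos (fs l) = pos l

  f≤n : ∀ i → f i ≤ n
  f≤n fz     = y≤n
  f≤n (fs l) = bound l

  f-inj : Injective _≡_ _≡_ f
  f-inj {fz}   {fz}   _     = refl
  f-inj {fz}   {fs l} y≡wl  = contradiction (l , sym y≡wl) miss
  f-inj {fs l} {fz}   wl≡y  = contradiction (l , wl≡y) miss
  f-inj {fs l} {fs m} wl≡wm = cong fs (inj l m wl≡wm)

lookup-ext : ∀ {n} {u v : Vec ℕ n} → (∀ i → lookup u i ≡ lookup v i) → u ≡ v
lookup-ext {u = u} {v} h =
  trans (sym (tabulate∘lookup u)) (trans (tabulate-cong h) (tabulate∘lookup v))

Monotone : ∀ {n} → Vec ℕ n → Set
Monotone a = ∀ {i j} → i Fin.≤ j → lookup a i ≤ lookup a j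

Adjacent-≤ : ∀ {n} → Vec ℕ n → Set
Adjacent-≤ a = ∀ i j → toℕ j ≡ suc (toℕ i) → lookup a i ≤ lookup a j

adjacent-≤-tail : ∀ {n x} {xs : Vec ℕ n} → Adjacent-≤ (x ∷ xs) → Adjacent-≤ xs
adjacent-≤-tail step i j j≡i+1 = step (fs i) (fs j) (cong suc j≡i+1)

adjacent-≤⇒monotone : ∀ {n} (a : Vec ℕ n) → Adjacent-≤ a → Monotone a
adjacent-≤⇒monotone (x ∷ xs)     step {fz}   {fz}   _ = ≤-refl
adjacent-≤⇒monotone (x ∷ y ∷ xs) step {fz}   {fs j} _ =
  ≤-trans (step fz (fs fz) refl) (adjacent-≤⇒monotone (y ∷ xs) (adjacent-≤-tail step) {fz} {j} z≤n)
adjacent-≤⇒monotone (x ∷ xs)     step {fs i} {fs j} (s≤s i≤j) =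
  adjacent-≤⇒monotone xs (adjacent-≤-tail step) i≤j

flag-monotone : ∀ {n t} {a : Vec ℕ n} → Flag n t a → Monotone a
flag-monotone {a = a} flag = adjacent-≤⇒monotone a (Flag.weak-incr flag)

record IsMaxFree (Used : ℕ → Set) (x m : ℕ) : Set where
  field
    bounded : m ≤ x
    free    : m ≡ 0 ⊎ ¬ Used m
    filled  : ∀ {y} → m < y → y ≤ x → Used y

isMaxFree-resp : ∀ {P Q : ℕ → Set} {x m} → (∀ {y} → P y → Q y) → (∀ {y} → Q y → P y) →
  IsMaxFree P x m → IsMaxFree Q x m
isMaxFree-resp P⇒Q Q⇒P r = record
  { bounded = bounded
  ; free    = map₂ (λ ¬Pm → ¬Pm ∘′ Q⇒P) free
  ; filled  = λ m<y y≤x → P⇒Q (filled m<y y≤x)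
  }
  where open IsMaxFree r

isMaxFree-self : ∀ {Used x m} → ¬ Used x → IsMaxFree Used x m → m ≡ x
isMaxFree-self ¬Used-x r with m≤n⇒m<n∨m≡n (IsMaxFree.bounded r)
... | inj₁ m<x = contradiction (IsMaxFree.filled r m<x ≤-refl) ¬Used-x
... | inj₂ m≡x = m≡x

maxFree-isMaxFree : ∀ used x → IsMaxFree (_∈ used) x (maxFree used x)
maxFree-isMaxFree used zero = record
  { bounded = z≤n ; free = inj₁ refl ; filled = λ m<y y≤0 → contradiction (<-≤-trans m<y y≤0) λ () }
maxFree-isMaxFree used (suc x) with suc x ∈? used
... | no  x+1∉used = record
  { bounded = ≤-refl
  ; free    = inj₂ x+1∉used
  ; filled  = λ x+1<y y≤x+1 → contradiction y≤x+1 (<⇒≱ x+1<y)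
  }
... | yes x+1∈used = record
  { bounded = m≤n⇒m≤1+n bounded
  ; free    = free
  ; filled  = λ {y} m<y y≤x+1 → case-y≤x+1 m<y (m≤n⇒m<n∨m≡n y≤x+1)
  }
  where
  open IsMaxFree (maxFree-isMaxFree used x)
  case-y≤x+1 : ∀ {y} → maxFree used x < y → y < suc x ⊎ y ≡ suc x → y ∈ used
  case-y≤x+1 m<y (inj₁ y≤x) = filled m<y (s≤s⁻¹ y≤x)
  case-y≤x+1 _   (inj₂ refl) = x+1∈used

maxFree-unique : ∀ {used x m} → IsMaxFree (_∈ used) x m → maxFree used x ≡ m
maxFree-unique {used} {zero} r = sym (n≤0⇒n≡0 (IsMaxFree.bounded r))
maxFree-unique {used} {suc x} {m} r with suc x ∈? used
... | no  x+1∉used = sym (isMaxFree-self x+1∉used r)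
... | yes x+1∈used = maxFree-unique record
  { bounded = m≤x
  ; free    = free
  ; filled  = λ m<y y≤x → filled m<y (m≤n⇒m≤1+n y≤x)
  }
  where
  open IsMaxFree r
  m≢x+1 : m ≢ suc x
  m≢x+1 refl with free
  ... | inj₂ x+1∉used = x+1∉used x+1∈used
  m≤x : m ≤ x
  m≤x = s≤s⁻¹ (≤∧≢⇒< bounded m≢x+1)

OccursBefore : ∀ {n} → Vec ℕ n → Fin n → ℕ → Set
OccursBefore w k y = ∃[ i ] i Fin.< k × lookup w i ≡ y

usedBefore : ∀ {n} → List ℕ → Vec ℕ n → Fin n → List ℕ
usedBefore used (x ∷ xs) fz     = used
usedBefore used (x ∷ xs) (fs k) = usedBefore (x ∷ used) xs k

∈-usedBefore⁻ : ∀ {n y} used (w : Vec ℕ n) k →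
  y ∈ usedBefore used w k → y ∈ used ⊎ OccursBefore w k y
∈-usedBefore⁻ used (x ∷ xs) fz     y∈used = inj₁ y∈used
∈-usedBefore⁻ used (x ∷ xs) (fs k) y∈ with ∈-usedBefore⁻ (x ∷ used) xs k y∈
... | inj₁ (here y≡x)        = inj₂ (fz , s≤s z≤n , sym y≡x)
... | inj₁ (there y∈used)    = inj₁ y∈used
... | inj₂ (i , i<k , wi≡y)  = inj₂ (fs i , s≤s i<k , wi≡y)

∈-usedBefore⁺ : ∀ {n y} used (w : Vec ℕ n) k →
  y ∈ used ⊎ OccursBefore w k y → y ∈ usedBefore used w k
∈-usedBefore⁺ used (x ∷ xs) fz     (inj₁ y∈used) = y∈used
∈-usedBefore⁺ used (x ∷ xs) (fs k) (inj₁ y∈used) =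
  ∈-usedBefore⁺ (x ∷ used) xs k (inj₁ (there y∈used))
∈-usedBefore⁺ used (x ∷ xs) (fs k) (inj₂ (fz , _ , x≡y)) =
  ∈-usedBefore⁺ (x ∷ used) xs k (inj₁ (here (sym x≡y)))
∈-usedBefore⁺ used (x ∷ xs) (fs k) (inj₂ (fs i , s≤s i<k , wi≡y)) =
  ∈-usedBefore⁺ (x ∷ used) xs k (inj₂ (i , i<k , wi≡y))

usedBefore[]⇒occursBefore : ∀ {n y} (w : Vec ℕ n) k → y ∈ usedBefore [] w k → OccursBefore w k y
usedBefore[]⇒occursBefore w k y∈ with ∈-usedBefore⁻ [] w k y∈
... | inj₂ occ = occ

occursBefore⇒usedBefore[] : ∀ {n y} (w : Vec ℕ n) k → OccursBefore w k y → y ∈ usedBefore [] w k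
occursBefore⇒usedBefore[] w k occ = ∈-usedBefore⁺ [] w k (inj₂ occ)

wGo-isMaxFree : ∀ {n} used (a : Vec ℕ n) k →
  IsMaxFree (_∈ usedBefore used (wGo used a) k) (lookup a k) (lookup (wGo used a) k)
wGo-isMaxFree used (x ∷ xs) fz     = maxFree-isMaxFree used x
wGo-isMaxFree used (x ∷ xs) (fs k) = wGo-isMaxFree (maxFree used x ∷ used) xs k

wGo-unique : ∀ {n} used (a w : Vec ℕ n) →
  (∀ k → IsMaxFree (_∈ usedBefore used w k) (lookup a k) (lookup w k)) → wGo used a ≡ w
wGo-unique used []       []       _ = refl
wGo-unique used (x ∷ xs) (y ∷ ys) h rewrite maxFree-unique (h fz) =
  cong (y ∷_) (wGo-unique (y ∷ used) xs ys λ k → h (fs k))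

record IsGreedy {n} (a w : Vec ℕ n) : Set where
  constructor greedy
  field
    isMaxFree : ∀ k → IsMaxFree (OccursBefore w k) (lookup a k) (lookup w k)

wOf-isGreedy : ∀ {n} (a : Vec ℕ n) → IsGreedy a (wOf a)
wOf-isGreedy a = greedy λ k → isMaxFree-resp
  (usedBefore[]⇒occursBefore (wOf a) k) (occursBefore⇒usedBefore[] (wOf a) k) (wGo-isMaxFree [] a k)

isGreedy⇒wOf≡ : ∀ {n} {a w : Vec ℕ n} → IsGreedy a w → wOf a ≡ w
isGreedy⇒wOf≡ {a = a} {w} (greedy g) = wGo-unique [] a w λ k → isMaxFree-resp
  (occursBefore⇒usedBefore[] w k) (usedBefore[]⇒occursBefore w k) (g k)

occursBefore? : ∀ {n} (w : Vec ℕ n) k y → Dec (OccursBefore w k y)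
occursBefore? w k y = Finₚ.any? λ i → (i Finₚ.<? k) ×-dec (lookup w i ≟ y)

isGreedy-attains : ∀ {n} {a w : Vec ℕ n} → IsGreedy a w →
  ∀ k → ∃[ i ] i Fin.≤ k × lookup w i ≡ lookup a k
isGreedy-attains {a = a} {w} (greedy g) k with occursBefore? w k (lookup a k)
... | yes (i , i<k , wi≡ak) = i , <⇒≤ i<k , wi≡ak
... | no  ak-fresh          = k , ≤-refl , isMaxFree-self ak-fresh (g k)

occursBefore-all⇒≤ : ∀ {n m} (w : Vec ℕ n) k →
  (∀ {y} → 1 ≤ y → y ≤ m → OccursBefore w k y) → m ≤ toℕ k
occursBefore-all⇒≤ {m = m} w k occurs = injective-positive-≤⇒≤ f f-inj (λ _ → s≤s z≤n) f≤k
  where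
  occurrence : ∀ (y : Fin m) → OccursBefore w k (suc (toℕ y))
  occurrence y = occurs (s≤s z≤n) (Finₚ.toℕ<n y)

  f : Fin m → ℕ
  f y = suc (toℕ (proj₁ (occurrence y)))

  f≤k : ∀ y → f y ≤ toℕ k
  f≤k y = proj₁ (proj₂ (occurrence y))

  f-inj : Injective _≡_ _≡_ f
  f-inj {y} {y′} fy≡fy′ = Finₚ.toℕ-injective (suc-injective (begin
    suc (toℕ y)                       ≡⟨ proj₂ (proj₂ (occurrence y)) ⟨
    lookup w (proj₁ (occurrence y))   ≡⟨ cong (lookup w) (Finₚ.toℕ-injective (suc-injective fy≡fy′)) ⟩
    lookup w (proj₁ (occurrence y′))  ≡⟨ proj₂ (proj₂ (occurrence y′)) ⟩
    suc (toℕ y′)                      ∎))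
    where open ≡-Reasoning

prefixMax : ∀ {n} → Vec ℕ n → Vec ℕ n
prefixMax []       = []
prefixMax (x ∷ xs) = x ∷ map (x ⊔_) (prefixMax xs)

lookup-prefixMax-suc : ∀ {n} x (xs : Vec ℕ n) k →
  lookup (prefixMax (x ∷ xs)) (fs k) ≡ x ⊔ lookup (prefixMax xs) k
lookup-prefixMax-suc x xs k = lookup-map k (x ⊔_) (prefixMax xs)

prefixMax-upper : ∀ {n} (v : Vec ℕ n) {i k} → i Fin.≤ k → lookup v i ≤ lookup (prefixMax v) k
prefixMax-upper (x ∷ xs) {fz}   {fz}   _ = ≤-refl
prefixMax-upper (x ∷ xs) {fz}   {fs k} _ rewrite lookup-prefixMax-suc x xs k = m≤m⊔n x _
prefixMax-upper (x ∷ xs) {fs i} {fs k} (s≤s i≤k) rewrite lookup-prefixMax-suc x xs k =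
  ≤-trans (prefixMax-upper xs i≤k) (m≤n⊔m x _)

prefixMax-least : ∀ {n} (v : Vec ℕ n) k {x} →
  (∀ i → i Fin.≤ k → lookup v i ≤ x) → lookup (prefixMax v) k ≤ x
prefixMax-least (y ∷ ys) fz     h = h fz z≤n
prefixMax-least (y ∷ ys) (fs k) h rewrite lookup-prefixMax-suc y ys k =
  ⊔-lub (h fz z≤n) (prefixMax-least ys k λ i i≤k → h (fs i) (s≤s i≤k))

prefixMax-attained : ∀ {n} (v : Vec ℕ n) k → ∃[ i ] i Fin.≤ k × lookup v i ≡ lookup (prefixMax v) k
prefixMax-attained (x ∷ xs) fz = fz , z≤n , refl
prefixMax-attained (x ∷ xs) (fs k)
  rewrite lookup-prefixMax-suc x xs k with ⊔-sel x (lookup (prefixMax xs) k)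
... | inj₁ max≡x  = fz , z≤n , sym max≡x
... | inj₂ max≡xs with prefixMax-attained xs k
...   | i , i≤k , xsi≡ = fs i , s≤s i≤k , trans xsi≡ (sym max≡xs)

prefixMax-monotone : ∀ {n} (v : Vec ℕ n) {i j} →
  i Fin.≤ j → lookup (prefixMax v) i ≤ lookup (prefixMax v) j
prefixMax-monotone v {i} i≤j = prefixMax-least v i λ l l≤i → prefixMax-upper v (≤-trans l≤i i≤j)

prefixMax-unique : ∀ {n} (v : Vec ℕ n) k {x} → (∀ i → i Fin.≤ k → lookup v i ≤ x) →
  (∃[ i ] i Fin.≤ k × lookup v i ≡ x) → lookup (prefixMax v) k ≡ x
prefixMax-unique v k bounded (i , i≤k , vi≡x) =
  ≤-antisym (prefixMax-least v k bounded) (subst (_≤ _) vi≡x (prefixMax-upper v i≤k))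

prefixMax-lower : ∀ {n} (v : Vec ℕ n) → Injective _≡_ _≡_ (lookup v) → (∀ i → 1 ≤ lookup v i) →
  ∀ k → suc (toℕ k) ≤ lookup (prefixMax v) k
prefixMax-lower v v-inj v-pos k = injective-positive-≤⇒≤ f f-inj (λ y → v-pos (embed y)) f≤max
  where
  embed : Fin (suc (toℕ k)) → Fin _
  embed y = inject≤ y (Finₚ.toℕ<n k)

  f : Fin (suc (toℕ k)) → ℕ
  f y = lookup v (embed y)

  f-inj : Injective _≡_ _≡_ f
  f-inj fy≡fy′ = Finₚ.inject≤-injective _ _ _ _ (v-inj fy≡fy′)

  f≤max : ∀ y → f y ≤ lookup (prefixMax v) k
  f≤max y = prefixMax-upper v (subst (_≤ toℕ k) (sym (Finₚ.toℕ-inject≤ y _)) (s≤s⁻¹ (Finₚ.toℕ<n y)))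

prefixMax-attained-isAscent : ∀ {n} (v : Vec ℕ n) → Injective _≡_ _≡_ (lookup v) →
  ∀ {j k} → j Fin.≤ k → lookup v j ≡ lookup (prefixMax v) k → IsAscent v j
prefixMax-attained-isAscent v v-inj {fz}   _ _ = inj₁ refl
prefixMax-attained-isAscent v v-inj {fs j} {k} j+1≤k vj+1≡max =
  inj₂ (inject₁ j , cong suc (sym (Finₚ.toℕ-inject₁ j)) , ≤∧≢⇒< previous≤ previous≢)
  where
  previous<j+1 : inject₁ j Fin.< fs j
  previous<j+1 = Finₚ.≤̄⇒inject₁< ≤-refl

  previous≤ : lookup v (inject₁ j) ≤ lookup v (fs j)
  previous≤ = subst (_ ≤_) (sym vj+1≡max) (prefixMax-upper v (≤-trans (<⇒≤ previous<j+1) j+1≤k))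

  previous≢ : lookup v (inject₁ j) ≢ lookup v (fs j)
  previous≢ e = Finₚ.<-irrefl (v-inj e) previous<j+1

isGreedy⇒prefixMax≡ : ∀ {n} {a w : Vec ℕ n} → IsGreedy a w → Monotone a → prefixMax w ≡ a
isGreedy⇒prefixMax≡ {w = w} g a-mono = lookup-ext λ k → prefixMax-unique w k
  (λ i i≤k → ≤-trans (IsMaxFree.bounded (IsGreedy.isMaxFree g i)) (a-mono {i} {k} i≤k))
  (isGreedy-attains g k)

module FromFlag {n t} {a w : Vec ℕ n} (flag : Flag n t a) (g : IsGreedy a w) where
  open Flag flag
  open IsGreedy g

  filled-before : ∀ k {y} → lookup w k < y → y ≤ lookup a k → OccursBefore w k y
  filled-before k = IsMaxFree.filled (isMaxFree k)

  w≤a : ∀ {i k} → i Fin.≤ k → lookup w i ≤ lookup a k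
  w≤a {i} {k} i≤k = ≤-trans (IsMaxFree.bounded (isMaxFree i)) (flag-monotone flag {i} {k} i≤k)

  w-positive : ∀ k → 1 ≤ lookup w k
  w-positive k = n≢0⇒n>0 λ wk≡0 → 1+n≰n (≤-trans (lower k) (occursBefore-all⇒≤ w k λ 1≤y y≤ak →
    filled-before k (subst (_< _) (sym wk≡0) 1≤y) y≤ak))

  w-fresh : ∀ k → ¬ OccursBefore w k (lookup w k)
  w-fresh k with IsMaxFree.free (isMaxFree k)
  ... | inj₁ wk≡0   = contradiction wk≡0 (>⇒≢ (w-positive k))
  ... | inj₂ wk-new = wk-new

  w-injective : Injective _≡_ _≡_ (lookup w)
  w-injective {i} {j} wi≡wj with Finₚ.<-cmp i j
  ... | tri< i<j _ _ = contradiction (i , i<j , wi≡wj) (w-fresh j)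
  ... | tri≈ _ i≡j _ = i≡j
  ... | tri> _ _ j<i = contradiction (j , j<i , sym wi≡wj) (w-fresh i)

  w-isPerm : IsPerm n w
  w-isPerm = record
    { pos   = w-positive
    ; bound = λ i → ≤-trans (IsMaxFree.bounded (isMaxFree i)) (upper i)
    ; inj   = λ _ _ → w-injective
    }

  w-avoids312 : Avoids312 w
  w-avoids312 (i , j , k , i<j , j<k , wj<wk , wk<wi)
    with filled-before j wj<wk (≤-trans (<⇒≤ wk<wi) (w≤a {i} {j} (<⇒≤ i<j)))
  ... | l , l<j , wl≡wk = w-fresh k (l , <-trans l<j j<k , wl≡wk)

  ascent-fixed : ∀ k → IsAscent w k → lookup w k ≡ lookup a k
  ascent-fixed k ascent = isMaxFree-self (ak-new ascent) (isMaxFree k)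
    where
    ak-new : IsAscent w k → ¬ OccursBefore w k (lookup a k)
    ak-new (inj₁ k≡0) (l , l<k , _) = n≮0 (subst (toℕ l <_) k≡0 l<k)
    ak-new (inj₂ (i , k≡i+1 , wi<wk)) (l , l<k , wl≡ak)
      with filled-before i wi<wk (begin
        lookup w k  ≤⟨ IsMaxFree.bounded (isMaxFree k) ⟩
        lookup a k  ≡⟨ wl≡ak ⟨
        lookup w l  ≤⟨ w≤a {l} {i} (s≤s⁻¹ (subst (toℕ l <_) k≡i+1 l<k)) ⟩
        lookup a i  ∎)
      where open ≤-Reasoning
    ... | m , m<i , wm≡wk =
      w-fresh k (m , <-trans m<i (subst (toℕ i <_) (sym k≡i+1) ≤-refl) , wm≡wk)

  w-good : Good n t w
  w-good = w-isPerm , w-avoids312 , λ k ascent → subst (t ∣_) (sym (ascent-fixed k ascent)) (mult k)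

module FromGood {n t} {w : Vec ℕ n} (good : Good n t w) where
  w-isPerm : IsPerm n w
  w-isPerm = proj₁ good

  w-avoids312 : Avoids312 w
  w-avoids312 = proj₁ (proj₂ good)

  ascent-mult : ∀ k → IsAscent w k → t ∣ lookup w k
  ascent-mult = proj₂ (proj₂ good)

  open IsPerm w-isPerm

  a : Vec ℕ n
  a = prefixMax w

  w-injective : Injective _≡_ _≡_ (lookup w)
  w-injective = inj _ _

  a-upper : ∀ k → lookup a k ≤ n
  a-upper k with prefixMax-attained w k
  ... | j , _ , wj≡ak = subst (_≤ n) wj≡ak (bound j)

  a-mult : ∀ k → t ∣ lookup a k
  a-mult k with prefixMax-attained w k
  ... | j , j≤k , wj≡ak =
    subst (t ∣_) wj≡ak (ascent-mult j (prefixMax-attained-isAscent w w-injective {j} {k} j≤k wj≡ak))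

  a-flag : Flag n t a
  a-flag = record
    { weak-incr = λ i j j≡i+1 →
        prefixMax-monotone w {i} {j} (subst (toℕ i ≤_) (sym j≡i+1) (n≤1+n _))
    ; lower     = prefixMax-lower w w-injective pos
    ; upper     = a-upper
    ; mult      = a-mult
    }

  filled-before : ∀ k {y} → lookup w k < y → y ≤ lookup a k → OccursBefore w k y
  filled-before k {y} wk<y y≤ak
    with isPerm-surjective w-isPerm (≤-trans (s≤s z≤n) wk<y) (≤-trans y≤ak (a-upper k))
  ... | l , wl≡y with Finₚ.<-cmp l k
  ... | tri< l<k _ _  = l , l<k , wl≡y
  ... | tri≈ _ refl _ = contradiction wl≡y (<⇒≢ wk<y)
  ... | tri> _ _ k<l  with prefixMax-attained w k
  ...   | j , j≤k , wj≡ak with m≤n⇒m<n∨m≡n j≤k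
  ...     | inj₂ j≡k rewrite Finₚ.toℕ-injective j≡k =
    contradiction (subst (y ≤_) (sym wj≡ak) y≤ak) (<⇒≱ wk<y)
  ...     | inj₁ j<k = contradiction (j , k , l , j<k , k<l , wk<wl , wl<wj) w-avoids312
    where
    wk<wl : lookup w k < lookup w l
    wk<wl = subst (_ <_) (sym wl≡y) wk<y
    wl<wj : lookup w l < lookup w j
    wl<wj = ≤∧≢⇒< (subst₂ _≤_ (sym wl≡y) (sym wj≡ak) y≤ak)
                  (λ wl≡wj → Finₚ.<-irrefl (sym (w-injective wl≡wj)) (<-trans j<k k<l))

  w-greedy : IsGreedy a w
  w-greedy = greedy λ k → record
    { bounded = prefixMax-upper w {k} {k} ≤-refl
    ; free    = inj₂ λ (i , i<k , wi≡wk) → Finₚ.<-irrefl (w-injective wi≡wk) i<k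
    ; filled  = filled-before k
    }

prefixMax-wOf : ∀ {n t} {a : Vec ℕ n} → Flag n t a → prefixMax (wOf a) ≡ a
prefixMax-wOf {a = a} flag = isGreedy⇒prefixMax≡ (wOf-isGreedy a) (flag-monotone flag)

mainTheorem3 : (n t : ℕ) → 1 ≤ n → 1 ≤ t →
    ((a : Vec ℕ n) → Flag n t a → Good n t (wOf a)) ×
    ((a b : Vec ℕ n) → Flag n t a → Flag n t b → wOf a ≡ wOf b → a ≡ b) ×
    ((w : Vec ℕ n) → Good n t w → Σ (Vec ℕ n) λ a → Flag n t a × wOf a ≡ w)
mainTheorem3 n t _ _ = well-defined , injective , surjective
  where
  well-defined : (a : Vec ℕ n) → Flag n t a → Good n t (wOf a)
  well-defined a flag = FromFlag.w-good flag (wOf-isGreedy a)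

  injective : (a b : Vec ℕ n) → Flag n t a → Flag n t b → wOf a ≡ wOf b → a ≡ b
  injective a b flag-a flag-b wa≡wb = begin
    a                  ≡⟨ prefixMax-wOf flag-a ⟨
    prefixMax (wOf a)  ≡⟨ cong prefixMax wa≡wb ⟩
    prefixMax (wOf b)  ≡⟨ prefixMax-wOf flag-b ⟩
    b                  ∎
    where open ≡-Reasoning

  surjective : (w : Vec ℕ n) → Good n t w → Σ (Vec ℕ n) λ a → Flag n t a × wOf a ≡ w
  surjective w good = prefixMax w , FromGood.a-flag good , isGreedy⇒wOf≡ (FromGood.w-greedy good)
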